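{- Let $m\in\mathbb{Z}_{>0}$. Then $$\left\{\mu\in\Lambda(m):\mu_1+\mu_2=m+2,\ \binom{m}{\mu_1-1}\not\equiv0\pmod p\right\}=\{(g_i+1,\ g_{t-i}+1,\ m): i\in\{0,1,\dots,t\}\}.$$
   Context: Let $p$ be a prime and $\Lambda(m)=\{\mu=(\mu_1,\mu_2,\mu_3)\in\mathbb{Z}_{\ge0}^3:\mu_3=m\}$; binomial coefficients $\binom{a}{b}$ are $0$ when $b<0$ or $b>a$. Write the base-$p$ expansion $n=\sum_{e\ge0}c_e(n)p^e$ with $0\le c_e(n)<p$. Let $G_m=\{g\in\mathbb{Z}_{\ge0}:c_e(g)\le c_e(m)\text{ for all }e\ge0\}=\{g_0,g_1,\dots,g_t\}$ with $0=g_0<g_1<\dots<g_t=m$. -}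

module Defs where

open import Data.Nat using (ℕ; zero; suc; _+_; _∸_; _^_; _≤_; _<_; NonZero)
open import Data.Nat.Properties using (m^n≢0)
open import Data.Nat.DivMod using (_/_; _%_)
open import Data.Nat.Combinatorics using (_C_)
open import Data.Nat.Divisibility using (_∣_)
open import Data.Fin using (Fin; toℕ)
open import Data.Product using (_×_; Σ)
open import Relation.Binary.PropositionalEquality using (_≡_)

digit : (p : ℕ) .{{_ : NonZero p}} → ℕ → ℕ → ℕ
digit p e n = (n / (p ^ e)) {{m^n≢0 p e}} % p

InG : (p : ℕ) .{{_ : NonZero p}} → ℕ → ℕ → Set
InG p m g = ∀ e → digit p e g ≤ digit p e m

-- binomial coefficient  binom(m, μ₁ - 1)  with the convention that it is 0
-- when μ₁ - 1 < 0 (i.e. μ₁ = 0); the case μ₁ - 1 > m is 0 already for _C_.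
binomPred : ℕ → ℕ → ℕ
binomPred m zero      = 0
binomPred m (suc k)   = m C k

IsIncEnum : (p : ℕ) .{{_ : NonZero p}} → ℕ → (t : ℕ) → (Fin (suc t) → ℕ) → Set
IsIncEnum p m t g =
  (∀ (i j : Fin (suc t)) → toℕ i < toℕ j → g i < g j) ×
  ((∀ i → InG p m (g i)) × (∀ x → InG p m x → Σ (Fin (suc t)) (λ i → g i ≡ x)))

{-# OPTIONS --safe #-}
-- Lucas' theorem gives  m C k ≡ (m % p C k % p) * (m / p C k / p)  (mod p); it is proved by
-- induction along Pascal's rule, the only non-exact case being a carry in the last digit of m,
-- where p ∣ p C j for 0 < j < p.  Iterating it, p ∤ m C k exactly when every base-p digit of k
-- is at most that of m, i.e. k ∈ G_m.  As m C k = m C (m ∸ k), G_m is closed under k ↦ m ∸ k, so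
-- i ↦ m ∸ g_{t-i} is a second increasing enumeration of G_m and hence g_{t-i} = m ∸ g_i.  Now
-- μ₁ = k + 1 with p ∤ m C k means k = g_i, and μ₁ + μ₂ = m + 2 forces μ₂ = g_{t-i} + 1.
module Submission where

open import Defs
open import Data.Nat using (ℕ; suc; _+_; _<_; NonZero)
open import Data.Nat.Primality using (Prime)
open import Data.Nat.Divisibility using (_∣_)
open import Data.Fin using (Fin; toℕ; opposite)
open import Data.Product using (_×_; ∃-syntax)
open import Function.Bundles using (_⇔_)
open import Relation.Nullary using (¬_)
open import Relation.Binary.PropositionalEquality using (_≡_)

open import Data.Nat using (zero; _*_; _∸_; _^_; _≤_; _!; z≤n; s≤s; >-nonZero⁻¹; nonTrivial⇒n>1)
open import Data.Nat.Properties
open import Data.Nat.DivMod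
open import Data.Nat.Combinatorics
  using (_C_; nCk≡n!/k![n-k]!; k![n∸k]!∣n!; k>n⇒nCk≡0; nCn≡1; nCk≡nC[n∸k]; nCk+nC[k+1]≡[n+1]C[k+1])
open import Data.Nat.Divisibility
  using (_∤_; divides-refl; ∣-trans; m∣m*n; n∣m*n; _∣0; >⇒∤; m%n≡0⇒n∣m; n∣m⇒m%n≡0)
open import Data.Nat.Primality using (euclidsLemma; prime⇒nonZero; prime⇒nonTrivial)
open import Data.Nat.Induction using (<-wellFounded)
open import Data.Fin.Base using () renaming (_<_ to _<ᶠ_)
open import Data.Fin.Induction using () renaming (<-wellFounded to <ᶠ-wellFounded)
open import Data.Fin.Properties using (toℕ-injective; toℕ<n; opposite-prop; opposite-involutive)
open import Data.Product using (_,_; Σ)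
open import Data.Product.Function.NonDependent.Propositional using (_×-⇔_)
open import Data.Sum using (inj₁; inj₂; [_,_])
open import Function.Base using (_∘_; id)
open import Function.Bundles using (mk⇔; Equivalence)
open import Function.Construct.Symmetry using (⇔-sym)
open import Function.Related.Propositional using (equivalence; module EquationalReasoning)
open import Function.Related.TypeIsomorphisms using (¬-cong-⇔)
open import Induction.WellFounded using (Acc; acc)
open import Relation.Nullary using (yes; no; contradiction)
open import Relation.Binary.PropositionalEquality
  using (refl; sym; trans; cong; cong₂; subst; subst₂; module ≡-Reasoning)

open Equivalence using (to; from)

∤nCk⇒k≤n : ∀ {d n k} → d ∤ n C k → k ≤ n
∤nCk⇒k≤n {d} d∤nCk = ≮⇒≥ (λ n<k → d∤nCk (subst (d ∣_) (sym (k>n⇒nCk≡0 n<k)) (d ∣0)))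

nCk*[k!*[n∸k]!]≡n! : ∀ {n k} → k ≤ n → (n C k) * (k ! * (n ∸ k) !) ≡ n !
nCk*[k!*[n∸k]!]≡n! {n} {k} k≤n =
  trans (cong (_* (k ! * (n ∸ k) !)) (nCk≡n!/k![n-k]! k≤n)) (m/n*n≡m {{_}} (k![n∸k]!∣n! k≤n))

n∣n! : ∀ n .{{_ : NonZero n}} → n ∣ n !
n∣n! (suc n) = m∣m*n (n !)

pascal-* : ∀ n k x → (n C k) * x + (n C suc k) * x ≡ (suc n C suc k) * x
pascal-* n k x = trans (sym (*-distribʳ-+ x (n C k) (n C suc k))) (cong (_* x) (nCk+nC[k+1]≡[n+1]C[k+1] n k))

suc[a]+b≡m+2⇔b≡[m∸a]+1 : ∀ {a m} b → a ≤ m → (suc a + b ≡ m + 2) ⇔ (b ≡ (m ∸ a) + 1)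
suc[a]+b≡m+2⇔b≡[m∸a]+1 {a} {m} b a≤m = mk⇔
  (λ eq → suc-injective (+-cancelˡ-≡ a _ _ (trans (+-suc a b) (trans eq m+2≡a+suc[[m∸a]+1]))))
  (λ eq → trans (sym (+-suc a b)) (trans (cong (λ c → a + suc c) eq) (sym m+2≡a+suc[[m∸a]+1])))
  where
  open ≡-Reasoning
  m+2≡a+suc[[m∸a]+1] : m + 2 ≡ a + suc ((m ∸ a) + 1)
  m+2≡a+suc[[m∸a]+1] = begin
    m + 2               ≡⟨ cong (_+ 2) (m+[n∸m]≡n a≤m) ⟨
    a + (m ∸ a) + 2     ≡⟨ +-assoc a (m ∸ a) 2 ⟩
    a + ((m ∸ a) + 2)   ≡⟨ cong (a +_) (+-suc (m ∸ a) 1) ⟩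
    a + suc ((m ∸ a) + 1) ∎

module _ {d : ℕ} .{{_ : NonZero d}} where

  0%d≡0 : 0 % d ≡ 0
  0%d≡0 = n∣m⇒m%n≡0 0 d (d ∣0)

  %≡⇒∣⇒∣ : ∀ {a b} → a % d ≡ b % d → d ∣ a → d ∣ b
  %≡⇒∣⇒∣ {a} {b} a≡b d∣a = m%n≡0⇒n∣m b d (trans (sym a≡b) (n∣m⇒m%n≡0 a d d∣a))

  %≡⇒∣⇔∣ : ∀ {a b} → a % d ≡ b % d → d ∣ a ⇔ d ∣ b
  %≡⇒∣⇔∣ a≡b = mk⇔ (%≡⇒∣⇒∣ a≡b) (%≡⇒∣⇒∣ (sym a≡b))

  [r+a*d]%d≡r : ∀ {r} a → r < d → (r + a * d) % d ≡ r
  [r+a*d]%d≡r {r} a r<d = trans ([m+kn]%n≡m%n r a d) (m<n⇒m%n≡m r<d)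

  [r+a*d]/d≡a : ∀ {r} a → r < d → (r + a * d) / d ≡ a
  [r+a*d]/d≡a {r} a r<d = begin
    (r + a * d) / d    ≡⟨ +-distrib-/-∣ʳ r (divides-refl a) ⟩
    r / d + a * d / d  ≡⟨ cong₂ _+_ (m<n⇒m/n≡0 r<d) (m*n/n≡m a d) ⟩
    a                  ∎
    where open ≡-Reasoning

  data SucDigits (n : ℕ) : ℕ → ℕ → Set where
    no-carry : suc (n % d) < d → SucDigits n (suc (n % d)) (n / d)
    carry    : suc (n % d) ≡ d → SucDigits n 0 (suc (n / d))

  private
    sucDigits-of : ∀ {n r a} → SucDigits n r a → r < d → suc n ≡ r + a * d → SucDigits n (suc n % d) (suc n / d)
    sucDigits-of {a = a} v r<d eq = subst₂ (SucDigits _)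
      (sym (trans (cong (_% d) eq) ([r+a*d]%d≡r a r<d)))
      (sym (trans (cong (_/ d) eq) ([r+a*d]/d≡a a r<d)))
      v

  sucDigits : ∀ n → SucDigits n (suc n % d) (suc n / d)
  sucDigits n with suc (n % d) <? d
  ... | yes r+1<d = sucDigits-of (no-carry r+1<d) r+1<d (cong suc (m≡m%n+[m/n]*n n d))
  ... | no  r+1≮d = sucDigits-of (carry r+1≡d) (>-nonZero⁻¹ d)
                      (trans (cong suc (m≡m%n+[m/n]*n n d)) (cong (_+ n / d * d) r+1≡d))
    where
    r+1≡d : suc (n % d) ≡ d
    r+1≡d = ≤-antisym (m%n<n n d) (≮⇒≥ r+1≮d)

  digit-zero : ∀ n → digit d 0 n ≡ n % d
  digit-zero n = cong (_% d) (n/1≡n n)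

  digit-suc : ∀ e n → digit d (suc e) n ≡ digit d e (n / d)
  digit-suc e n = cong (_% d) (sym (m/n/o≡m/[n*o] n d (d ^ e) {{_}} {{m^n≢0 d e}} {{m^n≢0 d (suc e)}}))

  InG-zero : ∀ m → InG d m 0
  InG-zero m e = subst (_≤ digit d e m) (sym (trans (cong (_% d) (0/n≡0 (d ^ e) {{m^n≢0 d e}})) 0%d≡0)) z≤n

  InG⇔%≤%×InG/ : ∀ m k → InG d m k ⇔ (k % d ≤ m % d × InG d (m / d) (k / d))
  InG⇔%≤%×InG/ m k = mk⇔
    (λ G → subst₂ _≤_ (digit-zero k) (digit-zero m) (G 0)
         , λ e → subst₂ _≤_ (digit-suc e k) (digit-suc e m) (G (suc e)))
    (λ where (k%d≤m%d , G) zero    → subst₂ _≤_ (sym (digit-zero k)) (sym (digit-zero m)) k%d≤m%d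
             (k%d≤m%d , G) (suc e) → subst₂ _≤_ (sym (digit-suc e k)) (sym (digit-suc e m)) (G e))

module _ {p : ℕ} (p-prime : Prime p) where

  private instance
    p≢0 : NonZero p
    p≢0 = prime⇒nonZero p-prime

  1<p : 1 < p
  1<p = nonTrivial⇒n>1 p {{prime⇒nonTrivial p-prime}}

  p∤m*n⇔p∤m×p∤n : ∀ m n → p ∤ m * n ⇔ (p ∤ m × p ∤ n)
  p∤m*n⇔p∤m×p∤n m n = mk⇔
    (λ p∤mn → (λ p∣m → p∤mn (∣-trans p∣m (m∣m*n n))) , (λ p∣n → p∤mn (∣-trans p∣n (n∣m*n m))))
    (λ (p∤m , p∤n) → [ p∤m , p∤n ] ∘ euclidsLemma m n p-prime)

  p∤n! : ∀ {n} → n < p → p ∤ n !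
  p∤n! {zero}  _     = >⇒∤ 1<p
  p∤n! {suc n} 1+n<p = from (p∤m*n⇔p∤m×p∤n (suc n) (n !)) (>⇒∤ 1+n<p , p∤n! (<-trans (n<1+n n) 1+n<p))

  p∤rCs⇔s≤r : ∀ {r s} → r < p → p ∤ r C s ⇔ s ≤ r
  p∤rCs⇔s≤r {r} {s} r<p = mk⇔ ∤nCk⇒k≤n
    (λ s≤r p∣rCs → p∤n! r<p (subst (p ∣_) (nCk*[k!*[n∸k]!]≡n! s≤r) (∣-trans p∣rCs (m∣m*n _))))

  p∣pCj : ∀ {j} → 0 < j → j < p → p ∣ p C j
  p∣pCj {j} 0<j j<p =
    [ id , (λ p∣j!*[p∸j]! → contradiction p∣j!*[p∸j]! p∤j!*[p∸j]!) ] (euclidsLemma (p C j) _ p-prime p∣p!)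
    where
    p∣p! : p ∣ (p C j) * (j ! * (p ∸ j) !)
    p∣p! = subst (p ∣_) (sym (nCk*[k!*[n∸k]!]≡n! (<⇒≤ j<p))) (n∣n! p)
    p∤j!*[p∸j]! : p ∤ j ! * (p ∸ j) !
    p∤j!*[p∸j]! = from (p∤m*n⇔p∤m×p∤n _ _) (p∤n! j<p , p∤n! (∸-monoʳ-< 0<j (<⇒≤ j<p)))

  lucasTerm : ℕ → ℕ → ℕ
  lucasTerm n k = ((n % p) C (k % p)) * ((n / p) C (k / p))

  lucasTerm[n,0]≡1 : ∀ n → lucasTerm n 0 ≡ 1
  lucasTerm[n,0]≡1 n = cong₂ (λ x y → ((n % p) C x) * ((n / p) C y)) 0%d≡0 (0/n≡0 p)

  lucasTerm[0,1+k]≡0 : ∀ k → lucasTerm 0 (suc k) ≡ 0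
  lucasTerm[0,1+k]≡0 k =
    trans (cong₂ (λ x y → (x C (suc k % p)) * (y C (suc k / p))) 0%d≡0 (0/n≡0 p)) (vanish (sucDigits k))
    where
    vanish : ∀ {s b} → SucDigits {p} k s b → (0 C s) * (0 C b) ≡ 0
    vanish (no-carry _) = refl
    vanish (carry _)    = refl

  lucasTerm-pascal : ∀ n k → (lucasTerm n k + lucasTerm n (suc k)) % p ≡ lucasTerm (suc n) (suc k) % p
  lucasTerm-pascal n k = go (sucDigits n) (sucDigits k)
    where
    open ≡-Reasoning
    r s a b : ℕ
    r = n % p
    s = k % p
    a = n / p
    b = k / p
    go : ∀ {r′ a′ s′ b′} → SucDigits {p} n r′ a′ → SucDigits {p} k s′ b′ →
         ((r C s) * (a C b) + (r C s′) * (a C b′)) % p ≡ ((r′ C s′) * (a′ C b′)) % p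
    go (no-carry _) (no-carry _) = cong (_% p) (pascal-* r s (a C b))
    go (no-carry r+1<p) (carry s+1≡p) =
      cong (λ x → (x * (a C b) + (r C 0) * (a C suc b)) % p) (k>n⇒nCk≡0 r<s)
      where
      r<s : r < s
      r<s = ≤-pred (subst (suc r <_) (sym s+1≡p) r+1<p)
    go (carry r+1≡p) (no-carry s+1<p) = begin
      ((r C s) * (a C b) + (r C suc s) * (a C b)) % p ≡⟨ cong (_% p) (pascal-* r s (a C b)) ⟩
      ((suc r C suc s) * (a C b)) % p                 ≡⟨ n∣m⇒m%n≡0 _ p p∣[r+1Cs+1]*[aCb] ⟩
      0                                               ≡⟨ 0%d≡0 ⟨
      0 % p                                           ∎
      where
      p∣[r+1Cs+1]*[aCb] : p ∣ (suc r C suc s) * (a C b)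
      p∣[r+1Cs+1]*[aCb] = ∣-trans (subst (λ q → p ∣ q C suc s) (sym r+1≡p) (p∣pCj (s≤s z≤n) s+1<p)) (m∣m*n _)
    go (carry r+1≡p) (carry s+1≡p) = cong (_% p) (begin
      (r C s) * (a C b) + 1 * (a C suc b)   ≡⟨ cong (λ x → x * (a C b) + 1 * (a C suc b)) rCs≡1 ⟩
      1 * (a C b) + 1 * (a C suc b)         ≡⟨ *-distribˡ-+ 1 (a C b) (a C suc b) ⟨
      1 * (a C b + a C suc b)               ≡⟨ cong (1 *_) (nCk+nC[k+1]≡[n+1]C[k+1] a b) ⟩
      1 * (suc a C suc b)                   ∎)
      where
      rCs≡1 : r C s ≡ 1
      rCs≡1 = trans (cong (r C_) (suc-injective (trans s+1≡p (sym r+1≡p)))) (nCn≡1 r)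

  lucas : ∀ n k → (n C k) % p ≡ lucasTerm n k % p
  lucas n       zero    = cong (_% p) (sym (lucasTerm[n,0]≡1 n))
  lucas zero    (suc k) = cong (_% p) (sym (lucasTerm[0,1+k]≡0 k))
  lucas (suc n) (suc k) = begin
    (suc n C suc k) % p                                  ≡⟨ cong (_% p) (nCk+nC[k+1]≡[n+1]C[k+1] n k) ⟨
    (n C k + n C suc k) % p                              ≡⟨ %-distribˡ-+ (n C k) (n C suc k) p ⟩
    ((n C k) % p + (n C suc k) % p) % p                  ≡⟨ cong₂ (λ x y → (x + y) % p) (lucas n k) (lucas n (suc k)) ⟩
    (lucasTerm n k % p + lucasTerm n (suc k) % p) % p    ≡⟨ %-distribˡ-+ (lucasTerm n k) (lucasTerm n (suc k)) p ⟨
    (lucasTerm n k + lucasTerm n (suc k)) % p            ≡⟨ lucasTerm-pascal n k ⟩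
    lucasTerm (suc n) (suc k) % p                        ∎
    where open ≡-Reasoning

  p∤nCk⇔InG : ∀ n k → p ∤ n C k ⇔ InG p n k
  p∤nCk⇔InG n k = go k (<-wellFounded k) n
    where
    go : ∀ k → Acc _<_ k → ∀ n → p ∤ n C k ⇔ InG p n k
    go zero    _         n = mk⇔ (λ _ → InG-zero n) (λ _ → >⇒∤ 1<p)
    go (suc k) (acc rec) n = begin
      p ∤ n C suc k                                              ∼⟨ ¬-cong-⇔ (%≡⇒∣⇔∣ (lucas n (suc k))) ⟩
      p ∤ lucasTerm n (suc k)                                    ∼⟨ p∤m*n⇔p∤m×p∤n _ _ ⟩
      (p ∤ (n % p) C (suc k % p) × p ∤ (n / p) C (suc k / p))    ∼⟨ p∤rCs⇔s≤r (m%n<n n p) ×-⇔ IH ⟩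
      (suc k % p ≤ n % p × InG p (n / p) (suc k / p))            ∼⟨ ⇔-sym (InG⇔%≤%×InG/ n (suc k)) ⟩
      InG p n (suc k)                                            ∎
      where
      open EquationalReasoning {k = equivalence}
      IH : p ∤ (n / p) C (suc k / p) ⇔ InG p (n / p) (suc k / p)
      IH = go (suc k / p) (rec (m/n<m (suc k) p 1<p)) (n / p)

  InG⇒≤ : ∀ {m k} → InG p m k → k ≤ m
  InG⇒≤ {m} {k} = ∤nCk⇒k≤n ∘ from (p∤nCk⇔InG m k)

  InG⇒InG[m∸k] : ∀ {m k} → InG p m k → InG p m (m ∸ k)
  InG⇒InG[m∸k] {m} {k} G =
    to (p∤nCk⇔InG m (m ∸ k)) (subst (p ∤_) (nCk≡nC[n∸k] (InG⇒≤ G)) (from (p∤nCk⇔InG m k) G))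

StrictlyIncreasing : ∀ {n} → (Fin n → ℕ) → Set
StrictlyIncreasing f = ∀ i j → toℕ i < toℕ j → f i < f j

_∈Image_ : ∀ {n} → ℕ → (Fin n → ℕ) → Set
x ∈Image f = Σ (Fin _) (λ j → f j ≡ x)

opposite-< : ∀ {n} {i j : Fin n} → toℕ i < toℕ j → toℕ (opposite j) < toℕ (opposite i)
opposite-< {j = j} i<j = subst₂ _<_ (sym (opposite-prop j)) (sym (opposite-prop _)) (∸-monoʳ-< (s≤s i<j) (toℕ<n j))

module _ {n : ℕ} {f : Fin n → ℕ} (f-inc : StrictlyIncreasing f) where

  strictlyIncreasing⇒monotone : ∀ {i j} → toℕ i ≤ toℕ j → f i ≤ f j
  strictlyIncreasing⇒monotone {i} {j} i≤j with m≤n⇒m<n∨m≡n i≤j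
  ... | inj₁ i<j = <⇒≤ (f-inc i j i<j)
  ... | inj₂ i≡j = ≤-reflexive (cong f (toℕ-injective i≡j))

  image⊆⇒≤ : ∀ {h : Fin n → ℕ} → StrictlyIncreasing h → (∀ i → h i ∈Image f) → ∀ i → f i ≤ h i
  image⊆⇒≤ {h} h-inc h⊆f i = go i (<ᶠ-wellFounded i)
    where
    go : ∀ i → Acc _<ᶠ_ i → f i ≤ h i
    go i (acc rec) with h⊆f i
    ... | j , fj≡hi with toℕ j <? toℕ i
    ... | yes j<i = contradiction (go j (rec j<i)) (<⇒≱ (subst (h j <_) (sym fj≡hi) (h-inc j i j<i)))
    ... | no  j≮i = subst (f i ≤_) fj≡hi (strictlyIncreasing⇒monotone (≮⇒≥ j≮i))

image≡⇒≡ : ∀ {n} {f h : Fin n → ℕ} → StrictlyIncreasing f → StrictlyIncreasing h →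
           (∀ i → h i ∈Image f) → (∀ i → f i ∈Image h) → ∀ i → f i ≡ h i
image≡⇒≡ f-inc h-inc h⊆f f⊆h i = ≤-antisym (image⊆⇒≤ f-inc h-inc h⊆f i) (image⊆⇒≤ h-inc f-inc f⊆h i)

module _ {P : ℕ → Set} {m : ℕ} (P⇒≤ : ∀ {x} → P x → x ≤ m) (P-reflect : ∀ {x} → P x → P (m ∸ x)) where

  increasing-enumeration-reflect : ∀ {n} {g : Fin n → ℕ} → StrictlyIncreasing g → (∀ i → P (g i)) →
                                   (∀ x → P x → x ∈Image g) → ∀ i → g (opposite i) ≡ m ∸ g i
  increasing-enumeration-reflect {n} {g} g-inc g∈P P⊆g i = begin
    g (opposite i)                ≡⟨ image≡⇒≡ g-inc h-inc h⊆g g⊆h (opposite i) ⟩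
    m ∸ g (opposite (opposite i)) ≡⟨ cong (λ j → m ∸ g j) (opposite-involutive i) ⟩
    m ∸ g i                       ∎
    where
    open ≡-Reasoning
    h : Fin n → ℕ
    h j = m ∸ g (opposite j)
    h-inc : StrictlyIncreasing h
    h-inc j k j<k = ∸-monoʳ-< (g-inc _ _ (opposite-< j<k)) (P⇒≤ (g∈P (opposite j)))
    h⊆g : ∀ j → h j ∈Image g
    h⊆g j = P⊆g (h j) (P-reflect (g∈P (opposite j)))
    g⊆h : ∀ j → g j ∈Image h
    g⊆h j with P⊆g (m ∸ g j) (P-reflect (g∈P j))
    ... | k , gk≡m∸gj = opposite k , (begin
      m ∸ g (opposite (opposite k)) ≡⟨ cong (λ l → m ∸ g l) (opposite-involutive k) ⟩
      m ∸ g k                       ≡⟨ cong (m ∸_) gk≡m∸gj ⟩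
      m ∸ (m ∸ g j)                 ≡⟨ m∸[m∸n]≡n (P⇒≤ (g∈P j)) ⟩
      g j                           ∎)

proposition5p9 : (p : ℕ) .{{_ : NonZero p}} → Prime p → (m : ℕ) → 0 < m →
    (t : ℕ) (g : Fin (suc t) → ℕ) → IsIncEnum p m t g →
    (μ₁ μ₂ μ₃ : ℕ) →
    ((μ₃ ≡ m × μ₁ + μ₂ ≡ m + 2 × ¬ (p ∣ binomPred m μ₁))
      ⇔ (∃[ i ] (μ₁ ≡ g i + 1 × μ₂ ≡ g (opposite i) + 1 × μ₃ ≡ m)))
proposition5p9 p p-prime m _ t g (g-inc , g∈G , G⊆g) μ₁ μ₂ μ₃ =
  mk⇔ (binomial⇒enum μ₁ μ₂ μ₃) (enum⇒binomial μ₁ μ₂ μ₃)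
  where
  g-reflect : ∀ i → g (opposite i) ≡ m ∸ g i
  g-reflect = increasing-enumeration-reflect (InG⇒≤ p-prime) (InG⇒InG[m∸k] p-prime) g-inc g∈G G⊆g

  g≤m : ∀ i → g i ≤ m
  g≤m i = InG⇒≤ p-prime (g∈G i)

  binomial⇒enum : ∀ μ₁ μ₂ μ₃ → (μ₃ ≡ m × μ₁ + μ₂ ≡ m + 2 × p ∤ binomPred m μ₁) →
                  ∃[ i ] (μ₁ ≡ g i + 1 × μ₂ ≡ g (opposite i) + 1 × μ₃ ≡ m)
  binomial⇒enum zero    _  _ (_ , _ , p∤0) = contradiction (p ∣0) p∤0
  binomial⇒enum (suc k) μ₂ _ (μ₃≡m , sum , p∤mCk) with G⊆g k (to (p∤nCk⇔InG p-prime m k) p∤mCk)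
  ... | i , refl = i , +-comm 1 (g i)
                     , trans (to (suc[a]+b≡m+2⇔b≡[m∸a]+1 μ₂ (g≤m i)) sum) (cong (_+ 1) (sym (g-reflect i)))
                     , μ₃≡m

  enum⇒binomial : ∀ μ₁ μ₂ μ₃ → ∃[ i ] (μ₁ ≡ g i + 1 × μ₂ ≡ g (opposite i) + 1 × μ₃ ≡ m) →
                  (μ₃ ≡ m × μ₁ + μ₂ ≡ m + 2 × p ∤ binomPred m μ₁)
  enum⇒binomial _ _ _ (i , refl , refl , refl) rewrite +-comm (g i) 1 =
      refl
    , from (suc[a]+b≡m+2⇔b≡[m∸a]+1 _ (g≤m i)) (cong (_+ 1) (g-reflect i))
    , from (p∤nCk⇔InG p-prime m (g i)) (g∈G i)
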